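{- Let $n\geq 2$ be prime. Every element of $R^{\mathrm{GKS}}_n$ other than $0^n$ and $1^n$ has finite block code.
   Context: Bitstrings of length $n$ represent subsets of $[n]$; $\sigma(x_1\cdots x_n)=x_nx_1\cdots x_{n-1}$ and the necklace of $x$ is $\langle x\rangle=\{\sigma^i(x):i\ge0\}$. Block code: if $x=1^{a_1}0^{b_1}\cdots1^{a_r}0^{b_r}$ with $r\ge1$ and all $a_i,b_i\ge1$, then $\beta(x)=(a_1+b_1,\dots,a_r+b_r)$ and the block code is called finite; otherwise $\beta(x)=(\infty)$. Block codes are compared lexicographically. For prime $n$, $R^{\mathrm{GKS}}_n$ is the set of bitstrings whose block code is lexicographically minimal within their necklace (exactly one per necklace). -}

module Defs where

open import Data.Bool using (Bool; true; false)
open import Data.Nat using (ℕ; zero; suc; _+_; _<_)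
open import Data.List using (List; []; _∷_)
open import Data.Maybe using (Maybe; just; nothing)
open import Data.Product using (_×_; _,_; ∃)
open import Data.Vec using (Vec; toList; last; init) renaming ([] to []ᵥ; _∷_ to _∷ᵥ_)
open import Relation.Binary.PropositionalEquality using (_≡_)

σ : ∀ {n} → Vec Bool n → Vec Bool n
σ {zero} v = v
σ {suc m} v = last v ∷ᵥ init v

σ^ : ∀ {n} → ℕ → Vec Bool n → Vec Bool n
σ^ zero v = v
σ^ (suc i) v = σ (σ^ i v)

runs : List Bool → List (Bool × ℕ)
runs [] = []
runs (b ∷ bs) with runs bs
... | [] = (b , 1) ∷ []
... | (true , k) ∷ r with b
...   | true = (true , suc k) ∷ r
...   | false = (false , 1) ∷ (true , k) ∷ r
runs (b ∷ bs) | (false , k) ∷ r with b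
...   | false = (false , suc k) ∷ r
...   | true = (true , 1) ∷ (false , k) ∷ r

pairRuns : List (Bool × ℕ) → Maybe (List ℕ)
pairRuns [] = just []
pairRuns ((true , a) ∷ (false , b) ∷ r) with pairRuns r
... | just l = just ((a + b) ∷ l)
... | nothing = nothing
pairRuns _ = nothing

-- block code: just (a₁+b₁,…,a_r+b_r) when finite (r ≥ 1), nothing = (∞)
β : ∀ {n} → Vec Bool n → Maybe (List ℕ)
β v with pairRuns (runs (toList v))
... | just [] = nothing
... | just (c ∷ cs) = just (c ∷ cs)
... | nothing = nothing

data _≤lex_ : List ℕ → List ℕ → Set where
  []≤   : ∀ {ys} → [] ≤lex ys
  here  : ∀ {x y xs ys} → x < y → (x ∷ xs) ≤lex (y ∷ ys)
  there : ∀ {x xs ys} → xs ≤lex ys → (x ∷ xs) ≤lex (x ∷ ys)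

-- lexicographic ≤ on block codes; (∞) is the one-entry sequence whose entry
-- exceeds every natural number, so every finite code is < (∞)
data _≤β_ : Maybe (List ℕ) → Maybe (List ℕ) → Set where
  fin≤fin : ∀ {xs ys} → xs ≤lex ys → just xs ≤β just ys
  fin≤∞   : ∀ {xs} → just xs ≤β nothing
  ∞≤∞     : nothing ≤β nothing

InRGKS : ∀ {n} → Vec Bool n → Set
InRGKS x = ∀ i → β x ≤β β (σ^ i x)

FiniteBlockCode : ∀ {n} → Vec Bool n → Set
FiniteBlockCode x = ∃ λ l → β x ≡ just l

module Submission where

open import Defs
open import Data.Bool using (Bool; true; false)
open import Data.Nat using (ℕ; zero; suc; _+_)
open import Data.Nat.Primality using (Prime)
open import Data.Vec using (Vec; replicate)
open import Relation.Binary.PropositionalEquality using (_≢_)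

import Data.Vec as Vec
import Data.Vec.Properties as Vec
open import Data.List as List using (List; []; _∷_; _++_; _∷ʳ_; length)
import Data.List.Properties as List
open import Data.Maybe using (just)
open import Data.Product using (_×_; _,_; ∃; ∃₂)
open import Data.Sum using (_⊎_; inj₁; inj₂)
open import Data.Empty using (⊥-elim)
open import Relation.Binary.PropositionalEquality
  using (_≡_; refl; sym; trans; cong; cong₂; subst; module ≡-Reasoning)

-- Some rotation of a non-constant bitstring begins with 1 and ends with 0 (cut
-- it just after a 0 that is followed by a 1), and the runs of such a string
-- pair up as 1^{a₁}0^{b₁}⋯1^{a_r}0^{b_r}, so its block code is finite. A finite
-- code is lexicographically below (∞), so the minimal code of the necklace, β x,
-- is finite.

data Alternating : List (Bool × ℕ) → Set where
  []    : Alternating []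
  block : ∀ {a b r} → Alternating r → Alternating ((true , a) ∷ (false , b) ∷ r)

pairRuns-alternating : ∀ {r} → Alternating r → ∃ λ l → pairRuns r ≡ just l
pairRuns-alternating [] = [] , refl
pairRuns-alternating (block {a} {b} alt) with pairRuns-alternating alt
... | l , eq rewrite eq = a + b ∷ l , refl

data EndsInZeroRuns : List (Bool × ℕ) → Set where
  oneZero : ∀ {a b r} → Alternating r → EndsInZeroRuns ((true , a) ∷ (false , b) ∷ r)
  zero⁺   : ∀ {k r} → Alternating r → EndsInZeroRuns ((false , k) ∷ r)

runs-∷ʳ-false : ∀ cs → EndsInZeroRuns (runs (cs ∷ʳ false))
runs-∷ʳ-false [] = zero⁺ []
runs-∷ʳ-false (c ∷ cs) with runs (cs ∷ʳ false) | runs-∷ʳ-false cs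
runs-∷ʳ-false (true  ∷ cs) | _ | oneZero alt = oneZero alt
runs-∷ʳ-false (false ∷ cs) | _ | oneZero alt = zero⁺ (block alt)
runs-∷ʳ-false (true  ∷ cs) | _ | zero⁺ alt   = oneZero alt
runs-∷ʳ-false (false ∷ cs) | _ | zero⁺ alt   = zero⁺ alt

runs-1⋯0 : ∀ cs → ∃₂ λ a b → ∃ λ r →
           runs (true ∷ cs ∷ʳ false) ≡ (true , a) ∷ (false , b) ∷ r × Alternating r
runs-1⋯0 cs with runs (cs ∷ʳ false) | runs-∷ʳ-false cs
... | _ | oneZero alt = _ , _ , _ , refl , alt
... | _ | zero⁺ alt   = _ , _ , _ , refl , alt

β-pairRuns : ∀ {n} (v : Vec Bool n) {c l} →
             pairRuns (runs (Vec.toList v)) ≡ just (c ∷ l) → β v ≡ just (c ∷ l)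
β-pairRuns v eq with pairRuns (runs (Vec.toList v))
β-pairRuns v refl | _ = refl

β-1⋯0 : ∀ {n} (v : Vec Bool n) {cs} → Vec.toList v ≡ true ∷ cs ∷ʳ false → FiniteBlockCode v
β-1⋯0 v {cs} v≡1cs0 with runs-1⋯0 cs
... | a , b , r , runs≡ , alt with pairRuns-alternating alt
...   | l , pairRuns≡ = a + b ∷ l , β-pairRuns v pairRuns-v
  where
  pairRuns-v : pairRuns (runs (Vec.toList v)) ≡ just (a + b ∷ l)
  pairRuns-v rewrite v≡1cs0 | runs≡ | pairRuns≡ = refl

toList-σ : ∀ {n} (v : Vec Bool n) ys y → Vec.toList v ≡ ys ∷ʳ y → Vec.toList (σ v) ≡ y ∷ ys
toList-σ {zero}  Vec.[] []      y ()
toList-σ {zero}  Vec.[] (_ ∷ _) y ()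
toList-σ {suc m} v ys y v≡ys∷ʳy with Vec.initLast v
... | init , last , refl
  with List.∷ʳ-injective (Vec.toList init) ys
         (trans (sym (Vec.toList-∷ʳ last init)) v≡ys∷ʳy)
... | init≡ys , last≡y = cong₂ _∷_ last≡y init≡ys

toList-σ^ : ∀ {n} (x : Vec Bool n) A B → Vec.toList x ≡ A ++ B →
            Vec.toList (σ^ (length B) x) ≡ B ++ A
toList-σ^ x A []      x≡A = trans x≡A (List.++-identityʳ A)
toList-σ^ x A (b ∷ B) x≡AbB =
  toList-σ (σ^ (length B) x) (B ++ A) b
    (trans (toList-σ^ x (A ∷ʳ b) B (trans x≡AbB (sym (List.++-assoc A (b ∷ []) B))))
           (sym (List.++-assoc B A (b ∷ []))))

01-infix⊎1ᵃ0ᵇ : ∀ (l : List Bool) →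
                (∃₂ λ A C → l ≡ A ++ false ∷ true ∷ C) ⊎
                (∃₂ λ a b → l ≡ List.replicate a true ++ List.replicate b false)
01-infix⊎1ᵃ0ᵇ [] = inj₂ (0 , 0 , refl)
01-infix⊎1ᵃ0ᵇ (c ∷ l) with 01-infix⊎1ᵃ0ᵇ l
... | inj₁ (A , C , eq) = inj₁ (c ∷ A , C , cong (c ∷_) eq)
01-infix⊎1ᵃ0ᵇ (true  ∷ l) | inj₂ (a     , b , eq) = inj₂ (suc a , b , cong (true ∷_) eq)
01-infix⊎1ᵃ0ᵇ (false ∷ l) | inj₂ (zero  , b , eq) = inj₂ (0 , suc b , cong (false ∷_) eq)
01-infix⊎1ᵃ0ᵇ (false ∷ l) | inj₂ (suc a , b , eq) = inj₁ ([] , _ , cong (false ∷_) eq)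

toList≡replicate⇒≡replicate : ∀ {n} (x : Vec Bool n) c k →
                              Vec.toList x ≡ List.replicate k c → x ≡ replicate n c
toList≡replicate⇒≡replicate Vec.[]       c k       eq = refl
toList≡replicate⇒≡replicate (y Vec.∷ xs) c zero    ()
toList≡replicate⇒≡replicate (y Vec.∷ xs) c (suc k) eq =
  cong₂ Vec._∷_ (List.∷-injectiveˡ eq)
                (toList≡replicate⇒≡replicate xs c k (List.∷-injectiveʳ eq))

replicate-suc-∷ʳ : ∀ k (c : Bool) → List.replicate (suc k) c ≡ List.replicate k c ∷ʳ c
replicate-suc-∷ʳ zero    c = refl
replicate-suc-∷ʳ (suc k) c = cong (c ∷_) (replicate-suc-∷ʳ k c)

rotation-1⋯0 : ∀ {n} (x : Vec Bool n) → x ≢ replicate n false → x ≢ replicate n true →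
               ∃₂ λ i cs → Vec.toList (σ^ i x) ≡ true ∷ cs ∷ʳ false
rotation-1⋯0 x x≢0ⁿ x≢1ⁿ with 01-infix⊎1ᵃ0ᵇ (Vec.toList x)
... | inj₁ (A , C , x≡A01C) =
  length (true ∷ C) , C ++ A ,
  trans (toList-σ^ x (A ∷ʳ false) (true ∷ C)
                   (trans x≡A01C (sym (List.++-assoc A (false ∷ []) (true ∷ C)))))
        (cong (true ∷_) (sym (List.++-assoc C A (false ∷ []))))
... | inj₂ (zero , b , x≡0ᵇ) = ⊥-elim (x≢0ⁿ (toList≡replicate⇒≡replicate x false b x≡0ᵇ))
... | inj₂ (suc a , zero , x≡1ᵃ) =
  ⊥-elim (x≢1ⁿ (toList≡replicate⇒≡replicate x true (suc a)
                  (trans x≡1ᵃ (List.++-identityʳ _))))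
... | inj₂ (suc a , suc b , x≡1ᵃ0ᵇ) = 0 , List.replicate a true ++ List.replicate b false , (begin
  Vec.toList x
    ≡⟨ x≡1ᵃ0ᵇ ⟩
  true ∷ List.replicate a true ++ List.replicate (suc b) false
    ≡⟨ cong (λ zs → true ∷ List.replicate a true ++ zs) (replicate-suc-∷ʳ b false) ⟩
  true ∷ List.replicate a true ++ List.replicate b false ∷ʳ false
    ≡⟨ cong (true ∷_) (sym (List.++-assoc (List.replicate a true) _ (false ∷ []))) ⟩
  true ∷ (List.replicate a true ++ List.replicate b false) ∷ʳ false ∎)
  where open ≡-Reasoning

≤β-just : ∀ {m ys} → m ≤β just ys → ∃ λ l → m ≡ just l
≤β-just (fin≤fin _) = _ , refl

lemma17 : (n : ℕ) → Prime n → (x : Vec Bool n) → InRGKS x →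
    x ≢ replicate n false → x ≢ replicate n true → FiniteBlockCode x
lemma17 n _ x minimal x≢0ⁿ x≢1ⁿ with rotation-1⋯0 x x≢0ⁿ x≢1ⁿ
... | i , cs , σⁱx≡1cs0 with β-1⋯0 (σ^ i x) σⁱx≡1cs0
...   | l , βσⁱx≡l = ≤β-just (subst (β x ≤β_) βσⁱx≡l (minimal i))
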